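{- Consider a stable marriage instance with sets $M$ of men and $W$ of women, $|M|=|W|=n$. Suppose $(\mathcal{M},\mathcal{W})$ is a $0/1$-valued feasible pair. If each man $m$ is married to the woman he least prefers among $\{w:\mathcal{M}(m,w)=1\}$, and each woman $w$ is married to the man she least prefers among $\{m:\mathcal{W}(w,m)=0\}$, then the result is a stable marriage. Conversely, every stable marriage $P$ is encoded by a $0/1$-valued feasible pair as follows: $\mathcal{M}(m,w)=1$ if $w\succeq_m P(m)$ and $0$ otherwise; $\mathcal{W}(w,m)=0$ if $m\succeq_w P(w)$ and $1$ otherwise. These two mappings are inverses of each other.
   Context: Each person $p$ has a preference list $\pi_1(p)\succ_p\pi_2(p)\succ_p\cdots\succ_p\pi_n(p)$, a total order on all persons of the opposite sex ($\pi_1(p)$ most preferred). A marriage is a perfect matching $P$ between $M$ and $W$; it is stable if there is no pair $(m,w)$ with $w\succ_m P(m)$ and $m\succ_w P(w)$. A $0/1$-valued feasible pair consists of matrices $\mathcal{M}:M\times W\to\{0,1\}$ and $\mathcal{W}:W\times M\to\{0,1\}$ such that for every man $m$ and woman $w$: $\mathcal{M}(m,\pi_1(m))=1$, $\mathcal{W}(w,\pi_1(w))=0$, and for all $1<i\le n$, $\mathcal{M}(m,\pi_i(m))=\mathcal{M}(m,\pi_{i-1}(m))\wedge\mathcal{W}(\pi_{i-1}(m),m)$ and $\mathcal{W}(w,\pi_i(w))=\mathcal{W}(w,\pi_{i-1}(w))\vee\mathcal{M}(\pi_{i-1}(w),w)$. -}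

module Defs where

open import Data.Nat.Base using (ℕ; suc)
open import Data.Fin.Base using (Fin; toℕ; _<_; _≤_)
open import Data.Fin.Permutation using (Permutation′; _⟨$⟩ʳ_; _⟨$⟩ˡ_)
open import Data.Bool.Base using (Bool; true; false; _∧_; _∨_; T)
open import Data.Nat.Base as ℕ using (_≤ᵇ_)
open import Data.Product.Base using (_×_; Σ)
open import Relation.Binary.PropositionalEquality using (_≡_)
open import Relation.Nullary using (¬_)

-- A preference list of a person p is a permutation of Fin n:
-- (pref ⟨$⟩ʳ i) is π_{i+1}(p) (positions are 0-based), and
-- (pref ⟨$⟩ˡ q) is the (0-based) rank of q in p's list.
Prefs : ℕ → Set
Prefs n = Fin n → Permutation′ n

rank : ∀ {n} → Permutation′ n → Fin n → Fin n
rank p q = p ⟨$⟩ˡ q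

Prefers : ∀ {n} → Permutation′ n → Fin n → Fin n → Set
Prefers p x y = rank p x < rank p y

PrefersEq : ∀ {n} → Permutation′ n → Fin n → Fin n → Set
PrefersEq p x y = rank p x ≤ rank p y

LeastPreferredIn : ∀ {n} → Permutation′ n → (Fin n → Set) → Fin n → Set
LeastPreferredIn p S x = S x × (∀ y → S y → PrefersEq p y x)

-- A marriage: perfect matching, i.e. bijection men → women.
-- P ⟨$⟩ʳ m = P(m) (wife of m), P ⟨$⟩ˡ w = P(w) (husband of w).
Marriage : ℕ → Set
Marriage n = Permutation′ n

Stable : ∀ {n} → Prefs n → Prefs n → Marriage n → Set
Stable {n} πM πW P =
  ¬ (Σ (Fin n) λ m → Σ (Fin n) λ w →
       Prefers (πM m) w (P ⟨$⟩ʳ m) × Prefers (πW w) m (P ⟨$⟩ˡ w))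

Mat : ℕ → Set
Mat n = Fin n → Fin n → Bool

Feasible : ∀ {n} → Prefs n → Prefs n → Mat n → Mat n → Set
Feasible {n} πM πW 𝓜 𝓦 =
    (∀ m (i : Fin n) → toℕ i ≡ 0 → 𝓜 m (πM m ⟨$⟩ʳ i) ≡ true)
  × (∀ w (i : Fin n) → toℕ i ≡ 0 → 𝓦 w (πW w ⟨$⟩ʳ i) ≡ false)
  × (∀ m (i j : Fin n) → toℕ j ≡ suc (toℕ i) →
       𝓜 m (πM m ⟨$⟩ʳ j) ≡ (𝓜 m (πM m ⟨$⟩ʳ i) ∧ 𝓦 (πM m ⟨$⟩ʳ i) m))
  × (∀ w (i j : Fin n) → toℕ j ≡ suc (toℕ i) →
       𝓦 w (πW w ⟨$⟩ʳ j) ≡ (𝓦 w (πW w ⟨$⟩ʳ i) ∨ 𝓜 (πW w ⟨$⟩ʳ i) w))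

DecodesTo : ∀ {n} → Prefs n → Prefs n → Mat n → Mat n → Marriage n → Set
DecodesTo πM πW 𝓜 𝓦 P =
    (∀ m → LeastPreferredIn (πM m) (λ w → 𝓜 m w ≡ true) (P ⟨$⟩ʳ m))
  × (∀ w → LeastPreferredIn (πW w) (λ m → 𝓦 w m ≡ false) (P ⟨$⟩ˡ w))

encodeM : ∀ {n} → Prefs n → Marriage n → Mat n
encodeM πM P m w = toℕ (rank (πM m) w) ≤ᵇ toℕ (rank (πM m) (P ⟨$⟩ʳ m))

encodeW : ∀ {n} → Prefs n → Marriage n → Mat n
encodeW πW P w m = Data.Bool.Base.not
  (toℕ (rank (πW w) m) ≤ᵇ toℕ (rank (πW w) (P ⟨$⟩ˡ w)))

-- Read 𝓜(m,w) = 1 as "m accepts w" and 𝓦(w,m) = 0 as "w accepts m". Unfolding the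
-- feasibility recurrences along a preference list, a person accepts y exactly when
-- nobody he or she prefers to y accepts him or her back. Hence "accepted by each
-- other" is a partial matching, in which everybody accepts precisely the partners at
-- least as good as the match. Every man is matched: otherwise every woman accepts him,
-- so every woman is matched to a distinct man, and by counting so is he. Conversely, for a stable marriage
-- the encoding satisfies the recurrences by comparing ranks, where stability says that
-- a woman whom a man prefers to his wife prefers her husband to him.
module Submission where

open import Defs
open import Data.Nat.Base using (ℕ)
open import Data.Fin.Base using (Fin)
open import Data.Product.Base using (_×_; Σ)
open import Relation.Binary.PropositionalEquality using (_≡_)

open import Data.Bool.Base using (true; false; _∧_; _∨_; not)
open import Data.Bool.Properties
  using (T-≡; ⇔→≡; ¬-not; not-involutive; not-injective; ∨-∧-booleanAlgebra)
  renaming (_≟_ to _≟ᵇ_)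
open import Algebra.Lattice.Properties.BooleanAlgebra ∨-∧-booleanAlgebra using (deMorgan₁)
open import Data.Fin.Base using (toℕ; fromℕ<; inject; punchOut)
open import Data.Fin.Permutation
  using (Permutation′; _⟨$⟩ʳ_; _⟨$⟩ˡ_; inverseˡ; inverseʳ; flip; permutation)
open import Data.Fin.Properties
  using (toℕ-injective; toℕ-fromℕ<; toℕ-inject; toℕ<n; any?; _≟_;
         ¬∀⟶∃¬-smallest; injective⇒≤; punchOut-injective)
open import Data.Nat.Base using (zero; suc; _≤ᵇ_; _<_; _≤_)
import Data.Nat.Properties as ℕ
open import Data.Product.Base using (_,_; proj₁; proj₂; ∃; swap)
open import Data.Sum.Base using (inj₁; inj₂)
open import Function.Base using (_∘_)
open import Function.Bundles using (_⇔_; mk⇔; module Equivalence)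
open import Function.Construct.Composition using (_⇔-∘_)
open import Function.Construct.Symmetry using (⇔-sym)
open import Function.Definitions using (Injective; StrictlySurjective)
open import Relation.Binary.Definitions using (tri<; tri≈; tri>)
open import Relation.Binary.PropositionalEquality
  using (refl; sym; trans; cong; subst; _≢_; module ≡-Reasoning)
open import Relation.Nullary using (¬_; Dec; yes; no; contradiction)
open import Relation.Nullary.Decidable using (¬?; decidable-stable)

open Equivalence using (to; from)

private
  variable
    n : ℕ

≤ᵇ≡true⇔≤ : ∀ {a b} → (a ≤ᵇ b) ≡ true ⇔ a ≤ b
≤ᵇ≡true⇔≤ {a} {b} = mk⇔ (ℕ.≤ᵇ⇒≤ a b ∘ from T-≡) (to T-≡ ∘ ℕ.≤⇒≤ᵇ)

≤ᵇ≡false : ∀ {a b} → b < a → (a ≤ᵇ b) ≡ false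
≤ᵇ≡false b<a = ¬-not (ℕ.<⇒≱ b<a ∘ to ≤ᵇ≡true⇔≤)

≤ᵇ-suc : ∀ {r s} c → (r < s → c ≡ true) → (r ≡ s → c ≡ false) →
         (suc r ≤ᵇ s) ≡ (r ≤ᵇ s) ∧ c
≤ᵇ-suc {r} {s} c below at with ℕ.<-cmp r s
... | tri< r<s _ _ = trans (from ≤ᵇ≡true⇔≤ r<s)
  (sym (trans (cong (_∧ c) (from ≤ᵇ≡true⇔≤ (ℕ.<⇒≤ r<s))) (below r<s)))
... | tri≈ _ refl _ = trans (≤ᵇ≡false (ℕ.n<1+n r))
  (sym (trans (cong (_∧ c) (from ≤ᵇ≡true⇔≤ (ℕ.≤-refl {r}))) (at refl)))
... | tri> _ _ s<r =
  trans (≤ᵇ≡false (ℕ.m<n⇒m<1+n s<r)) (sym (cong (_∧ c) (≤ᵇ≡false s<r)))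

≡∧⇒≡true⇔ : ∀ {x y z} → x ≡ y ∧ z → x ≡ true ⇔ (y ≡ true × z ≢ false)
≡∧⇒≡true⇔ {y = false} refl = mk⇔ (λ ()) (λ { (() , _) })
≡∧⇒≡true⇔ {y = true} {false} refl = mk⇔ (λ ()) (λ (_ , z≢false) → contradiction refl z≢false)
≡∧⇒≡true⇔ {y = true} {true} refl = mk⇔ (λ _ → refl , λ ()) (λ _ → refl)

≡∨⇒≡false⇔ : ∀ {x y z} → x ≡ y ∨ z → x ≡ false ⇔ (y ≡ false × z ≢ true)
≡∨⇒≡false⇔ {y = true} refl = mk⇔ (λ ()) (λ { (() , _) })
≡∨⇒≡false⇔ {y = false} {true} refl = mk⇔ (λ ()) (λ (_ , z≢true) → contradiction refl z≢true)
≡∨⇒≡false⇔ {y = false} {false} refl = mk⇔ (λ _ → refl , λ ()) (λ _ → refl)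

rank-injective : (π : Permutation′ n) → Injective _≡_ _≡_ (rank π)
rank-injective π eq = trans (sym (inverseʳ π)) (trans (cong (π ⟨$⟩ʳ_) eq) (inverseʳ π))

⪰-antisym : (π : Permutation′ n) {x y : Fin n} → PrefersEq π x y → PrefersEq π y x → x ≡ y
⪰-antisym π x⪰y y⪰x = rank-injective π (toℕ-injective (ℕ.≤-antisym x⪰y y⪰x))

≻⇒≢ : (π : Permutation′ n) {x y : Fin n} → Prefers π x y → x ≢ y
≻⇒≢ π x≻y refl = ℕ.<-irrefl refl x≻y

rank-position : (π : Permutation′ n) (i : Fin n) → toℕ (rank π (π ⟨$⟩ʳ i)) ≡ toℕ i
rank-position π i = cong toℕ (inverseˡ π)

module _ {A B : Fin n → Set}
  (A-first : ∀ i → toℕ i ≡ 0 → A i)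
  (A-next : ∀ i j → toℕ j ≡ suc (toℕ i) → A j ⇔ (A i × B i)) where

  ⇔-all-below : ∀ t k → toℕ k ≡ t → A k ⇔ (∀ j → toℕ j < t → B j)
  ⇔-all-below zero k k≡0 = mk⇔ (λ _ _ ()) (λ _ → A-first k k≡0)
  ⇔-all-below (suc t) k k≡1+t = mk⇔ all-below A-k
    where
    t<n : t < n
    t<n = ℕ.<-trans (ℕ.n<1+n t) (subst (_< n) k≡1+t (toℕ<n k))
    i : Fin n
    i = fromℕ< t<n
    i≡t : toℕ i ≡ t
    i≡t = toℕ-fromℕ< t<n
    A-i⇔ : A i ⇔ (∀ j → toℕ j < t → B j)
    A-i⇔ = ⇔-all-below t i i≡t
    A-k⇔ : A k ⇔ (A i × B i)
    A-k⇔ = A-next i k (trans k≡1+t (cong suc (sym i≡t)))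
    all-below : A k → ∀ j → toℕ j < suc t → B j
    all-below a j j<1+t with ℕ.m<1+n⇒m<n∨m≡n j<1+t
    ... | inj₁ j<t = to A-i⇔ (proj₁ (to A-k⇔ a)) j j<t
    ... | inj₂ j≡t = subst B (toℕ-injective (trans i≡t (sym j≡t))) (proj₂ (to A-k⇔ a))
    A-k : (∀ j → toℕ j < suc t → B j) → A k
    A-k below = from A-k⇔
      ( from A-i⇔ (λ j j<t → below j (ℕ.m<n⇒m<1+n j<t))
      , below i (subst (_< suc t) (sym i≡t) (ℕ.n<1+n t)))

⇔-all-preferred : (π : Permutation′ n) {A B : Fin n → Set} →
  (∀ i → toℕ i ≡ 0 → A (π ⟨$⟩ʳ i)) →
  (∀ i j → toℕ j ≡ suc (toℕ i) → A (π ⟨$⟩ʳ j) ⇔ (A (π ⟨$⟩ʳ i) × B (π ⟨$⟩ʳ i))) →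
  ∀ x → A x ⇔ (∀ y → Prefers π y x → B y)
⇔-all-preferred π {A} {B} A-first A-next x = mk⇔ all-preferred A-x
  where
  A⇔ : A (π ⟨$⟩ʳ rank π x) ⇔ (∀ j → toℕ j < toℕ (rank π x) → B (π ⟨$⟩ʳ j))
  A⇔ = ⇔-all-below A-first A-next (toℕ (rank π x)) (rank π x) refl
  all-preferred : A x → ∀ y → Prefers π y x → B y
  all-preferred a y y≻x =
    subst B (inverseʳ π) (to A⇔ (subst A (sym (inverseʳ π)) a) (rank π y) y≻x)
  A-x : (∀ y → Prefers π y x → B y) → A x
  A-x all = subst A (inverseʳ π)
    (from A⇔ λ j j<x →
      all (π ⟨$⟩ʳ j) (subst (λ i → toℕ i < toℕ (rank π x)) (sym (inverseˡ π)) j<x))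

most-preferred : (π : Permutation′ n) {Q : Fin n → Set} → (∀ x → Dec (Q x)) →
  ∃ Q → ∃ λ x → Q x × (∀ y → Prefers π y x → ¬ Q y)
most-preferred {n} π {Q} Q? (x , qx)
  with i , ¬¬q , before ← ¬∀⟶∃¬-smallest n (λ i → ¬ Q (π ⟨$⟩ʳ i)) (λ i → ¬? (Q? (π ⟨$⟩ʳ i)))
                            (λ none → none (rank π x) (subst Q (sym (inverseʳ π)) qx))
  = π ⟨$⟩ʳ i , decidable-stable (Q? _) ¬¬q , none-preferred
  where
  none-preferred : ∀ y → Prefers π y (π ⟨$⟩ʳ i) → ¬ Q y
  none-preferred y y≻ =
    subst (¬_ ∘ Q) (inverseʳ π) (subst (¬_ ∘ Q ∘ (π ⟨$⟩ʳ_)) y-position (before j))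
    where
    y<i : toℕ (rank π y) < toℕ i
    y<i = subst (λ k → toℕ (rank π y) < toℕ k) (inverseˡ π) y≻
    j : Fin (toℕ i)
    j = fromℕ< y<i
    y-position : inject j ≡ rank π y
    y-position = toℕ-injective (trans (toℕ-inject j) (toℕ-fromℕ< y<i))

injective⇒strictlySurjective : {f : Fin n → Fin n} →
  Injective _≡_ _≡_ f → StrictlySurjective _≡_ f
injective⇒strictlySurjective {suc n} {f} f-injective y with any? (λ x → f x ≟ y)
... | yes hit = hit
... | no miss = contradiction (injective⇒≤ punched-injective) ℕ.1+n≰n
  where
  y≢f : ∀ x → y ≢ f x
  y≢f x y≡fx = miss (x , sym y≡fx)
  punched : Fin (suc n) → Fin n
  punched x = punchOut (y≢f x)
  punched-injective : Injective _≡_ _≡_ punched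
  punched-injective = f-injective ∘ punchOut-injective (y≢f _) (y≢f _)

module MutualAcceptance
  (π : Prefs n) (Accepts Accepts′ : Fin n → Fin n → Set)
  (accepts′? : ∀ y x → Dec (Accepts′ y x))
  (accepts⇔ : ∀ x y → Accepts x y ⇔ (∀ y′ → Prefers (π x) y′ y → ¬ Accepts′ y′ x)) where

  Matched : Fin n → Fin n → Set
  Matched x y = Accepts x y × Accepts′ y x

  accepts⇔⪰ : ∀ {x y y′} → Matched x y → Accepts x y′ ⇔ PrefersEq (π x) y′ y
  accepts⇔⪰ {x} {y} {y′} (accepts-y , accepted) = mk⇔
    (λ accepts-y′ → ℕ.≮⇒≥ λ y≻y′ → to (accepts⇔ x y′) accepts-y′ y y≻y′ accepted)
    (λ y′⪰y → from (accepts⇔ x y′) λ y″ y″≻y′ →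
      to (accepts⇔ x y) accepts-y y″ (ℕ.<-≤-trans y″≻y′ y′⪰y))

  matched-unique : ∀ {x y y′} → Matched x y → Matched x y′ → y ≡ y′
  matched-unique {x} m m′ =
    ⪰-antisym (π x) (to (accepts⇔⪰ m′) (proj₁ m)) (to (accepts⇔⪰ m) (proj₁ m′))

  matched-if-accepted : ∀ {x} → ∃ (λ y → Accepts′ y x) → ∃ (Matched x)
  matched-if-accepted {x} accepted
    with y , accepted-y , none-preferred ← most-preferred (π x) (λ y → accepts′? y x) accepted
    = y , from (accepts⇔ x y) none-preferred , accepted-y

encodeM≡true⇔ : (πM : Prefs n) (P : Marriage n) {m w : Fin n} →
  encodeM πM P m w ≡ true ⇔ PrefersEq (πM m) w (P ⟨$⟩ʳ m)
encodeM≡true⇔ _ _ = ≤ᵇ≡true⇔≤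

encodeW≡false⇔ : (πW : Prefs n) (P : Marriage n) {w m : Fin n} →
  encodeW πW P w m ≡ false ⇔ PrefersEq (πW w) m (P ⟨$⟩ˡ w)
encodeW≡false⇔ πW P = encodeM≡true⇔ πW (flip P) ⇔-∘ mk⇔ not-injective (cong not)

module Decoding (πM πW : Prefs n) (𝓜 𝓦 : Mat n) (feasible : Feasible πM πW 𝓜 𝓦) where

  ManAccepts WomanAccepts : Fin n → Fin n → Set
  ManAccepts m w = 𝓜 m w ≡ true
  WomanAccepts w m = 𝓦 w m ≡ false

  man-accepts⇔ : ∀ m w → ManAccepts m w ⇔ (∀ w′ → Prefers (πM m) w′ w → ¬ WomanAccepts w′ m)
  man-accepts⇔ m = ⇔-all-preferred (πM m) (proj₁ feasible m)
    (λ i j j≡1+i → ≡∧⇒≡true⇔ (proj₁ (proj₂ (proj₂ feasible)) m i j j≡1+i))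

  woman-accepts⇔ : ∀ w m → WomanAccepts w m ⇔ (∀ m′ → Prefers (πW w) m′ m → ¬ ManAccepts m′ w)
  woman-accepts⇔ w = ⇔-all-preferred (πW w) (proj₁ (proj₂ feasible) w)
    (λ i j j≡1+i → ≡∨⇒≡false⇔ (proj₂ (proj₂ (proj₂ feasible)) w i j j≡1+i))

  module Men = MutualAcceptance πM ManAccepts WomanAccepts (λ w m → 𝓦 w m ≟ᵇ false) man-accepts⇔
  module Women = MutualAcceptance πW WomanAccepts ManAccepts (λ m w → 𝓜 m w ≟ᵇ true) woman-accepts⇔

  man-matched : ∀ m → ∃ (Men.Matched m)
  man-matched m with any? (λ w → 𝓦 w m ≟ᵇ false)
  ... | yes accepted = Men.matched-if-accepted accepted
  ... | no rejected  = contradiction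
    (w₀ , proj₁ (subst (Women.Matched w₀) suitor-w₀≡m (suitor-matched w₀))) rejected
    where
    accepts-all : ∀ w → ManAccepts m w
    accepts-all w = from (man-accepts⇔ m w) λ w′ _ accepts → rejected (w′ , accepts)
    suitor : Fin n → Fin n
    suitor w = proj₁ (Women.matched-if-accepted (m , accepts-all w))
    suitor-matched : ∀ w → Women.Matched w (suitor w)
    suitor-matched w = proj₂ (Women.matched-if-accepted (m , accepts-all w))
    suitor-injective : Injective _≡_ _≡_ suitor
    suitor-injective {w} {w′} eq = Men.matched-unique (swap (suitor-matched w))
      (subst (λ x → Men.Matched x w′) (sym eq) (swap (suitor-matched w′)))
    w₀ : Fin n
    w₀ = proj₁ (injective⇒strictlySurjective suitor-injective m)
    suitor-w₀≡m : suitor w₀ ≡ m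
    suitor-w₀≡m = proj₂ (injective⇒strictlySurjective suitor-injective m)

  wife : Fin n → Fin n
  wife m = proj₁ (man-matched m)

  wife-matched : ∀ m → Men.Matched m (wife m)
  wife-matched m = proj₂ (man-matched m)

  wife-injective : Injective _≡_ _≡_ wife
  wife-injective {m} {m′} eq = Women.matched-unique (swap (wife-matched m))
    (subst (λ y → Women.Matched y m′) (sym eq) (swap (wife-matched m′)))

  wife-surjective : StrictlySurjective _≡_ wife
  wife-surjective = injective⇒strictlySurjective wife-injective

  P : Marriage n
  P = permutation wife (proj₁ ∘ wife-surjective) (proj₂ ∘ wife-surjective)
        (λ m → wife-injective (proj₂ (wife-surjective (wife m))))

  husband-matched : ∀ w → Women.Matched w (P ⟨$⟩ˡ w)
  husband-matched w =
    swap (subst (Men.Matched (P ⟨$⟩ˡ w)) (inverseʳ P) (wife-matched (P ⟨$⟩ˡ w)))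

  stable : Stable πM πW P
  stable (m , w , w≻wife , m≻husband) =
    to (woman-accepts⇔ w (P ⟨$⟩ˡ w)) (proj₁ (husband-matched w)) m m≻husband
      (from (Men.accepts⇔⪰ (wife-matched m)) (ℕ.<⇒≤ w≻wife))

  decodes : DecodesTo πM πW 𝓜 𝓦 P
  decodes = (λ m → proj₁ (wife-matched m) , λ w → to (Men.accepts⇔⪰ (wife-matched m)))
          , (λ w → proj₁ (husband-matched w) , λ m → to (Women.accepts⇔⪰ (husband-matched w)))

  encodeM-correct : ∀ m w → encodeM πM P m w ≡ 𝓜 m w
  encodeM-correct m w =
    ⇔→≡ (⇔-sym (Men.accepts⇔⪰ (wife-matched m)) ⇔-∘ encodeM≡true⇔ πM P)

  encodeW-correct : ∀ w m → encodeW πW P w m ≡ 𝓦 w m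
  encodeW-correct w m =
    ⇔→≡ (⇔-sym (Women.accepts⇔⪰ (husband-matched w)) ⇔-∘ encodeW≡false⇔ πW P)

encoding-decodes : (πM πW : Prefs n) (P : Marriage n) →
  DecodesTo πM πW (encodeM πM P) (encodeW πW P) P
encoding-decodes πM πW P =
    (λ m → from (encodeM≡true⇔ πM P) ℕ.≤-refl , λ w → to (encodeM≡true⇔ πM P))
  , (λ w → from (encodeW≡false⇔ πW P) ℕ.≤-refl , λ m → to (encodeW≡false⇔ πW P))

stable-flip : (πM πW : Prefs n) (P : Marriage n) → Stable πM πW P → Stable πW πM (flip P)
stable-flip _ _ _ stable (w , m , m≻husband , w≻wife) = stable (m , w , w≻wife , m≻husband)

stable⇒husband-preferred : (πM πW : Prefs n) (P : Marriage n) → Stable πM πW P →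
  ∀ {m w} → Prefers (πM m) w (P ⟨$⟩ʳ m) → Prefers (πW w) (P ⟨$⟩ˡ w) m
stable⇒husband-preferred πM πW P stable {m} {w} w≻wife =
  ℕ.≤∧≢⇒< (ℕ.≮⇒≥ λ m≻husband → stable (m , w , w≻wife , m≻husband)) husband≢m
  where
  husband≢m : toℕ (rank (πW w) (P ⟨$⟩ˡ w)) ≢ toℕ (rank (πW w) m)
  husband≢m eq = ≻⇒≢ (πM m) w≻wife
    (trans (sym (inverseʳ P)) (cong (P ⟨$⟩ʳ_) (rank-injective (πW w) (toℕ-injective eq))))

encodeM-first : (πM : Prefs n) (P : Marriage n) →
  ∀ m i → toℕ i ≡ 0 → encodeM πM P m (πM m ⟨$⟩ʳ i) ≡ true
encodeM-first πM P m i i≡0 = cong (_≤ᵇ _) (trans (rank-position (πM m) i) i≡0)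

encodeM-next : (πM πW : Prefs n) (P : Marriage n) → Stable πM πW P →
  ∀ m i j → toℕ j ≡ suc (toℕ i) →
  encodeM πM P m (πM m ⟨$⟩ʳ j) ≡ encodeM πM P m (πM m ⟨$⟩ʳ i) ∧ encodeW πW P (πM m ⟨$⟩ʳ i) m
encodeM-next {n} πM πW P stable m i j j≡1+i =
  trans (cong (_≤ᵇ _) rank-j) (≤ᵇ-suc (encodeW πW P w m) rejects accepts)
  where
  w : Fin n
  w = πM m ⟨$⟩ʳ i
  rank-j : toℕ (rank (πM m) (πM m ⟨$⟩ʳ j)) ≡ suc (toℕ (rank (πM m) w))
  rank-j = trans (rank-position (πM m) j)
    (trans j≡1+i (cong suc (sym (rank-position (πM m) i))))
  rejects : Prefers (πM m) w (P ⟨$⟩ʳ m) → encodeW πW P w m ≡ true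
  rejects w≻wife = cong not (≤ᵇ≡false (stable⇒husband-preferred πM πW P stable w≻wife))
  accepts : toℕ (rank (πM m) w) ≡ toℕ (rank (πM m) (P ⟨$⟩ʳ m)) → encodeW πW P w m ≡ false
  accepts eq rewrite rank-injective (πM m) (toℕ-injective eq) =
    from (encodeW≡false⇔ πW P)
      (ℕ.≤-reflexive (cong (toℕ ∘ rank (πW (P ⟨$⟩ʳ m))) (sym (inverseˡ P))))

-- Exchanging the roles of men and women (P ↦ flip P) turns encodeW into not ∘ encodeM,
-- so the women's clauses are the negated men's clauses of the flipped instance.
encoding-feasible : (πM πW : Prefs n) (P : Marriage n) → Stable πM πW P →
  Feasible πM πW (encodeM πM P) (encodeW πW P)
encoding-feasible πM πW P stable =
    encodeM-first πM P
  , (λ w i i≡0 → cong not (encodeM-first πW (flip P) w i i≡0))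
  , encodeM-next πM πW P stable
  , women-next
  where
  open ≡-Reasoning
  women-next : ∀ w i j → toℕ j ≡ suc (toℕ i) →
    encodeW πW P w (πW w ⟨$⟩ʳ j) ≡ encodeW πW P w (πW w ⟨$⟩ʳ i) ∨ encodeM πM P (πW w ⟨$⟩ʳ i) w
  women-next w i j j≡1+i = begin
    encodeW πW P w (πW w ⟨$⟩ʳ j)
      ≡⟨ cong not (encodeM-next πW πM (flip P) (stable-flip πM πW P stable) w i j j≡1+i) ⟩
    not (encodeM πW (flip P) w (πW w ⟨$⟩ʳ i) ∧ not (encodeM πM P (πW w ⟨$⟩ʳ i) w))
      ≡⟨ deMorgan₁ (encodeM πW (flip P) w (πW w ⟨$⟩ʳ i)) _ ⟩
    encodeW πW P w (πW w ⟨$⟩ʳ i) ∨ not (not (encodeM πM P (πW w ⟨$⟩ʳ i) w))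
      ≡⟨ cong (encodeW πW P w (πW w ⟨$⟩ʳ i) ∨_) (not-involutive _) ⟩
    encodeW πW P w (πW w ⟨$⟩ʳ i) ∨ encodeM πM P (πW w ⟨$⟩ʳ i) w
      ∎

lemma46 : (n : ℕ) (πM πW : Prefs n) →
    ((𝓜 𝓦 : Mat n) → Feasible πM πW 𝓜 𝓦 →
       Σ (Marriage n) λ P →
         Stable πM πW P × DecodesTo πM πW 𝓜 𝓦 P
         × (∀ m w → encodeM πM P m w ≡ 𝓜 m w)
         × (∀ w m → encodeW πW P w m ≡ 𝓦 w m))
    ×
    ((P : Marriage n) → Stable πM πW P →
       Feasible πM πW (encodeM πM P) (encodeW πW P)
       × DecodesTo πM πW (encodeM πM P) (encodeW πW P) P)
lemma46 n πM πW =
    (λ 𝓜 𝓦 feasible → let open Decoding πM πW 𝓜 𝓦 feasible in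
       P , stable , decodes , encodeM-correct , encodeW-correct)
  , λ P stable → encoding-feasible πM πW P stable , encoding-decodes πM πW P
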